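{- Let $D$ be a squarefree integer, let $C_D\subset\mathbb{P}^4$ be the curve over $\mathbb{Q}$ given by $$X_0^2-2X_1^2+X_2^2=0,\quad X_1^2-2X_2^2+DX_3^2=0,\quad X_2^2-2DX_3^2+X_4^2=0,$$ and let $p>3$ be a prime dividing $D$. Then $C_D(\mathbb{Q}_p)\neq\emptyset$ if and only if $p\equiv 1\pmod{24}$. -}

module Defs where

open import Data.Nat as ℕ using (ℕ; zero; suc)
open import Data.Integer as ℤ using (ℤ; +_; _+_; _-_; _*_)
open import Data.Integer.Divisibility using (_∣_)
open import Data.Fin using (Fin; zero; suc)
open import Data.Product using (Σ; ∃; _×_)
open import Relation.Nullary using (¬_)
open import Relation.Binary.PropositionalEquality using (_≡_)

-- The p-adic integers ℤ_p as the inverse limit lim ℤ/p^k: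
-- an element is a compatible system of residues  res k ∈ {0,…,p^k - 1}
-- with res (k+1) ≡ res k (mod p^k).
record Zp (p : ℕ) : Set where
  field
    res        : ℕ → ℕ
    res-<      : ∀ k → res k ℕ.< p ℕ.^ k
    res-compat : ∀ k → (+ (p ℕ.^ k)) ∣ ((+ res (suc k)) - (+ res k))

open Zp public

-- D squarefree: no square n² with n ≠ 1 divides D (so D ≠ 0).
SquareFree : ℤ → Set
SquareFree D = ∀ (n : ℕ) → (+ (n ℕ.* n)) ∣ D → n ≡ 1

sq : ℤ → ℤ
sq x = x * x

F₁ F₂ F₃ : ℤ → (Fin 5 → ℤ) → ℤ
F₁ D x = sq (x zero) - + 2 * sq (x (suc zero)) + sq (x (suc (suc zero)))
F₂ D x = sq (x (suc zero)) - + 2 * sq (x (suc (suc zero))) + D * sq (x (suc (suc (suc zero))))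
F₃ D x = sq (x (suc (suc zero))) - + 2 * D * sq (x (suc (suc (suc zero)))) + sq (x (suc (suc (suc (suc zero)))))

lvl : ∀ {p} → (Fin 5 → Zp p) → ℕ → Fin 5 → ℤ
lvl x k i = + res (x i) k

-- F(x) = 0 in ℤ_p  ⇔  for every k, F(x mod p^k) ≡ 0 (mod p^k)
VanishesZp : (p : ℕ) → ((Fin 5 → ℤ) → ℤ) → (Fin 5 → Zp p) → Set
VanishesZp p F x = ∀ k → (+ (p ℕ.^ k)) ∣ F (lvl x k)

-- x is primitive: some coordinate is a p-adic unit (nonzero mod p).
Primitive : ∀ {p} → (Fin 5 → Zp p) → Set
Primitive x = ∃ λ i → ¬ (res (x i) 1 ≡ 0)

-- C_D(ℚ_p) ≠ ∅, using ℙ⁴(ℚ_p) = {primitive vectors in ℤ_p⁵}/ℤ_p^×.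
HasQpPoint : ℤ → ℕ → Set
HasQpPoint D p = Σ (Fin 5 → Zp p) λ x →
  Primitive x × VanishesZp p (F₁ D) x × VanishesZp p (F₂ D) x × VanishesZp p (F₃ D) x

{-# OPTIONS --safe #-}
-- Reducing a primitive point modulo p forces x₂ to be a unit, since otherwise the second
-- quadric would give p² ∣ D; then x₁² ≡ 2x₂², x₄² ≡ -x₂² and x₀² ≡ 3x₂² (mod p). So -1 is a
-- square, and even a fourth power because (x₂ + x₄)² ≡ 2x₂x₄; by Fermat's little theorem this
-- gives 8 ∣ p - 1. Likewise (x₀x₄)² ≡ -3x₂⁴ yields a cube root of unity other than 1, so
-- 3 ∣ p - 1. Conversely, if 24 ∣ p - 1, a residue g with g^((p-1)/2) ≢ 1 (it exists because
-- X^d - 1 has at most d roots) gives a primitive 8th root of unity t, and one with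
-- g^((p-1)/3) ≢ 1 a primitive cube root of unity u. Then t², t - t³ and (2u + 1)t² are square
-- roots of -1, 2 and 3 mod p, which Hensel's lemma lifts to ℤ_p; (√3 : √2 : 1 : 0 : √-1) lies
-- on C_D.

module Submission where

open import Defs
open import Data.Nat as ℕ using (ℕ; zero; suc; _<_; _%_; s≤s; z≤n)
import Data.Nat.Properties as ℕP
import Data.Nat.Divisibility as ℕD
import Data.Nat.DivMod as ℕDM
open import Data.Nat.Coprimality using (coprime?; coprime-divisor)
open import Data.Nat.Primality using (Prime; euclidsLemma; prime⇒nonTrivial)
open import Data.Nat.Tactic.RingSolver renaming (solve-∀ to solveℕ)
open import Data.Integer as ℤ using (ℤ; +_; _+_; _-_; _*_; -_; _^_; ∣_∣; -1ℤ)
import Data.Integer.Properties as ℤP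
import Data.Integer.DivMod as ℤDM
open import Data.Integer.Divisibility using (_∣_)
open import Data.Integer.Divisibility.Signed as ℤD
  using (divides; ∣ᵤ⇒∣; ∣⇒∣ᵤ; ∣-refl; ∣-trans; ∣n⇒∣m*n; ∣m⇒∣m*n; ∣m∣n⇒∣m+n; ∣m∣n⇒∣m-n; ∣m⇒∣-m)
  renaming (_∣_ to _∣ₛ_)
open import Data.Integer.Tactic.RingSolver using (solve-∀)
open import Data.Sum using (_⊎_; inj₁; inj₂) renaming ([_,_]′ to either)
open import Data.Product using (Σ; ∃; _×_; _,_; proj₁; proj₂)
open import Data.Empty using (⊥-elim)
open import Data.Fin using (Fin; zero; suc)
open import Data.List using (List; []; _∷_; length)
open import Data.List.Relation.Unary.All using (All; []; _∷_)
open import Data.List.Relation.Unary.AllPairs using (AllPairs; []; _∷_)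
open import Function using (_∘_)
open import Function.Bundles using (_⇔_; mk⇔)
open import Level using (0ℓ)
open import Relation.Binary.Bundles using (Setoid)
import Relation.Binary.Reasoning.Setoid
open import Relation.Binary.PropositionalEquality
open import Relation.Nullary using (¬_; Dec; yes; no)
open import Relation.Nullary.Decidable using (from-yes; map′)

∣-respʳ-≡ : ∀ {m x y} → x ≡ y → m ∣ₛ x → m ∣ₛ y
∣-respʳ-≡ refl d = d

∣-zero : ∀ m → m ∣ₛ + 0
∣-zero m = divides (+ 0) refl

*-pres-∣ : ∀ {a b c d} → a ∣ₛ b → c ∣ₛ d → a * c ∣ₛ b * d
*-pres-∣ {a} {b} {c} {d} (divides q₁ refl) (divides q₂ refl) = divides (q₁ * q₂) (regroup q₁ a q₂ c)
  where regroup : ∀ q₁ a q₂ c → (q₁ * a) * (q₂ * c) ≡ (q₁ * q₂) * (a * c)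
        regroup = solve-∀

euclidsLemmaℤ : ∀ {p} → Prime p → ∀ a b → + p ∣ₛ a * b → + p ∣ₛ a ⊎ + p ∣ₛ b
euclidsLemmaℤ {p} p-prime a b p∣ab
  with euclidsLemma ∣ a ∣ ∣ b ∣ p-prime (subst (p ℕD.∣_) (ℤP.abs-* a b) (∣⇒∣ᵤ p∣ab))
... | inj₁ p∣a = inj₁ (∣ᵤ⇒∣ p∣a)
... | inj₂ p∣b = inj₂ (∣ᵤ⇒∣ p∣b)

%ℕ-∣ : ∀ a n .{{_ : ℕ.NonZero n}} → + n ∣ₛ a - + (a ℤ.%ℕ n)
%ℕ-∣ a n = divides (a ℤ./ℕ n) (cancel a (+ (a ℤ.%ℕ n)) _ (ℤDM.a≡a%ℕn+[a/ℕn]*n a n))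
  where cancel : ∀ a r q → a ≡ r + q → a - r ≡ q
        cancel _ r q refl = +-minus r q
          where +-minus : ∀ r q → r + q - r ≡ q
                +-minus = solve-∀

^-distribʳ-* : ∀ a b n → (a * b) ^ n ≡ a ^ n * b ^ n
^-distribʳ-* a b zero = refl
^-distribʳ-* a b (suc n) rewrite ^-distribʳ-* a b n = regroup a b (a ^ n) (b ^ n)
  where regroup : ∀ a b x y → a * b * (x * y) ≡ a * x * (b * y)
        regroup = solve-∀

^-double : ∀ x e → x ^ (e ℕ.+ e) ≡ (x * x) ^ e
^-double x e = trans (ℤP.^-distribˡ-+-* x e e) (sym (^-distribʳ-* x x e))

^-by-3s : ∀ x r q → x ^ (r ℕ.+ q ℕ.* 3) ≡ (x * (x * x)) ^ q * x ^ r
^-by-3s x r q = begin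
    x ^ (r ℕ.+ q ℕ.* 3)          ≡⟨ ℤP.^-distribˡ-+-* x r (q ℕ.* 3) ⟩
    x ^ r * x ^ (q ℕ.* 3)        ≡⟨ cong (λ k → x ^ r * x ^ k) (ℕP.*-comm q 3) ⟩
    x ^ r * x ^ (3 ℕ.* q)        ≡⟨ cong (x ^ r *_) (sym (ℤP.^-*-assoc x 3 q)) ⟩
    x ^ r * (x ^ 3) ^ q          ≡⟨ cong (λ c → x ^ r * (x * (x * c)) ^ q) (ℤP.*-identityʳ x) ⟩
    x ^ r * (x * (x * x)) ^ q    ≡⟨ ℤP.*-comm (x ^ r) _ ⟩
    (x * (x * x)) ^ q * x ^ r    ∎
  where open ≡-Reasoning

module Congruence (m : ℤ) where

  -- A record rather than a synonym for m ∣ a - b, so that a and b can be inferred from a proof.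
  infix 4 _≋_
  record _≋_ (a b : ℤ) : Set where
    constructor mk≋
    field ∣diff : m ∣ₛ a - b
  open _≋_ public

  ≋-refl : ∀ {a} → a ≋ a
  ≋-refl {a} = mk≋ (∣-respʳ-≡ (sym (ℤP.+-inverseʳ a)) (∣-zero m))

  ≋-reflexive : ∀ {a b} → a ≡ b → a ≋ b
  ≋-reflexive refl = ≋-refl

  ≋-sym : ∀ {a b} → a ≋ b → b ≋ a
  ≋-sym {a} {b} (mk≋ d) = mk≋ (∣-respʳ-≡ (negate a b) (∣m⇒∣-m d))
    where negate : ∀ a b → - (a - b) ≡ b - a
          negate = solve-∀

  ≋-trans : ∀ {a b c} → a ≋ b → b ≋ c → a ≋ c
  ≋-trans {a} {b} {c} (mk≋ d) (mk≋ e) = mk≋ (∣-respʳ-≡ (telescope a b c) (∣m∣n⇒∣m+n d e))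
    where telescope : ∀ a b c → (a - b) + (b - c) ≡ a - c
          telescope = solve-∀

  ≋-setoid : Setoid 0ℓ 0ℓ
  ≋-setoid = record
    { Carrier = ℤ
    ; _≈_ = _≋_
    ; isEquivalence = record { refl = ≋-refl ; sym = ≋-sym ; trans = ≋-trans }
    }

  module ≋-Reasoning = Relation.Binary.Reasoning.Setoid ≋-setoid

  +-cong : ∀ {a b c d} → a ≋ b → c ≋ d → a + c ≋ b + d
  +-cong {a} {b} {c} {d} (mk≋ x) (mk≋ y) = mk≋ (∣-respʳ-≡ (regroup a b c d) (∣m∣n⇒∣m+n x y))
    where regroup : ∀ a b c d → (a - b) + (c - d) ≡ (a + c) - (b + d)
          regroup = solve-∀

  sub-cong : ∀ {a b c d} → a ≋ b → c ≋ d → a - c ≋ b - d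
  sub-cong {a} {b} {c} {d} (mk≋ x) (mk≋ y) = mk≋ (∣-respʳ-≡ (regroup a b c d) (∣m∣n⇒∣m-n x y))
    where regroup : ∀ a b c d → (a - b) - (c - d) ≡ (a - c) - (b - d)
          regroup = solve-∀

  neg-cong : ∀ {a b} → a ≋ b → - a ≋ - b
  neg-cong {a} {b} (mk≋ x) = mk≋ (∣-respʳ-≡ (regroup a b) (∣m⇒∣-m x))
    where regroup : ∀ a b → - (a - b) ≡ (- a) - (- b)
          regroup = solve-∀

  *-cong : ∀ {a b c d} → a ≋ b → c ≋ d → a * c ≋ b * d
  *-cong {a} {b} {c} {d} (mk≋ x) (mk≋ y) =
    mk≋ (∣-respʳ-≡ (regroup a b c d) (∣m∣n⇒∣m+n (∣n⇒∣m*n a y) (∣m⇒∣m*n d x)))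
    where regroup : ∀ a b c d → a * (c - d) + (a - b) * d ≡ a * c - b * d
          regroup = solve-∀

  *-congˡ : ∀ a {b c} → b ≋ c → a * b ≋ a * c
  *-congˡ a = *-cong (≋-refl {a})

  *-congʳ : ∀ a {b c} → b ≋ c → b * a ≋ c * a
  *-congʳ a e = *-cong e (≋-refl {a})

  ^-cong : ∀ {a b} n → a ≋ b → a ^ n ≋ b ^ n
  ^-cong zero    _ = ≋-refl
  ^-cong (suc n) e = *-cong e (^-cong n e)

  ∣⇒≋0 : ∀ {a} → m ∣ₛ a → a ≋ + 0
  ∣⇒≋0 {a} d = mk≋ (∣-respʳ-≡ (sym (ℤP.+-identityʳ a)) d)

  ≋0⇒∣ : ∀ {a} → a ≋ + 0 → m ∣ₛ a
  ≋0⇒∣ {a} (mk≋ d) = ∣-respʳ-≡ (ℤP.+-identityʳ a) d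

  infix 4 _≋?_
  _≋?_ : ∀ a b → Dec (a ≋ b)
  a ≋? b = map′ mk≋ ∣diff (m ℤD.∣? (a - b))

  -- t is a primitive 8th root of unity and t - t³ = t + t⁻¹.
  √2-from-t⁴≋-1 : ∀ t → (t * t) * (t * t) ≋ -1ℤ → (t - t * (t * t)) * (t - t * (t * t)) ≋ + 2
  √2-from-t⁴≋-1 t t⁴≋-1 = mk≋ (∣-respʳ-≡ (expand t) (∣m⇒∣m*n (t * t - + 2) (∣diff t⁴≋-1)))
    where expand : ∀ t → ((t * t) * (t * t) - -1ℤ) * (t * t - + 2)
                          ≡ (t - t * (t * t)) * (t - t * (t * t)) - + 2
          expand = solve-∀

  √3-from-u²+u+1≋0 : ∀ u i → u * u + u + + 1 ≋ + 0 → i * i ≋ -1ℤ →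
                     ((+ 2 * u + + 1) * i) * ((+ 2 * u + + 1) * i) ≋ + 3
  √3-from-u²+u+1≋0 u i u²+u+1≋0 i²≋-1 =
    mk≋ (∣-respʳ-≡ (expand u i) (∣m∣n⇒∣m-n (∣n⇒∣m*n (+ 4 * (i * i)) (∣diff u²+u+1≋0)) (∣n⇒∣m*n (+ 3) (∣diff i²≋-1))))
    where expand : ∀ u i → + 4 * (i * i) * (u * u + u + + 1 - + 0) - + 3 * (i * i - -1ℤ)
                            ≡ (+ 2 * u + + 1) * i * ((+ 2 * u + + 1) * i) - + 3
          expand = solve-∀

  [a+b]²≋2ab : ∀ a b → b * b ≋ -1ℤ * (a * a) → (a + b) * (a + b) ≋ + 2 * a * b
  [a+b]²≋2ab a b b²≋-a² = mk≋ (∣-respʳ-≡ (expand a b) (∣diff b²≋-a²))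
    where expand : ∀ a b → b * b - -1ℤ * (a * a) ≡ (a + b) * (a + b) - + 2 * a * b
          expand = solve-∀

  [a+b]⁴≋-c⁴ : ∀ a b c → b * b ≋ -1ℤ * (a * a) → c * c ≋ + 2 * (a * a) →
               ((a + b) * (a + b)) * ((a + b) * (a + b)) ≋ -1ℤ * ((c * c) * (c * c))
  [a+b]⁴≋-c⁴ a b c b²≋-a² c²≋2a² = begin
      ((a + b) * (a + b)) * ((a + b) * (a + b))    ≈⟨ *-cong ([a+b]²≋2ab a b b²≋-a²) ([a+b]²≋2ab a b b²≋-a²) ⟩
      (+ 2 * a * b) * (+ 2 * a * b)                ≡⟨ regroup₁ a b ⟩
      + 4 * (a * a) * (b * b)                      ≈⟨ *-congˡ (+ 4 * (a * a)) b²≋-a² ⟩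
      + 4 * (a * a) * (-1ℤ * (a * a))              ≡⟨ regroup₂ a ⟩
      -1ℤ * ((+ 2 * (a * a)) * (+ 2 * (a * a)))    ≈⟨ *-congˡ -1ℤ (≋-sym (*-cong c²≋2a² c²≋2a²)) ⟩
      -1ℤ * ((c * c) * (c * c))                    ∎
    where
    open ≋-Reasoning
    regroup₁ : ∀ a b → (+ 2 * a * b) * (+ 2 * a * b) ≡ + 4 * (a * a) * (b * b)
    regroup₁ = solve-∀
    regroup₂ : ∀ a → + 4 * (a * a) * (-1ℤ * (a * a)) ≡ -1ℤ * ((+ 2 * (a * a)) * (+ 2 * (a * a)))
    regroup₂ = solve-∀

  -1≋square⇒-1^e≋1 : ∀ {u w} e → u * u ≋ -1ℤ * (w * w) → (u * u) ^ e ≋ + 1 → (w * w) ^ e ≋ + 1 →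
                     -1ℤ ^ e ≋ + 1
  -1≋square⇒-1^e≋1 {u} {w} e u²≋-w² u²ᵉ≋1 w²ᵉ≋1 = begin
      -1ℤ ^ e                   ≡⟨ sym (ℤP.*-identityʳ _) ⟩
      -1ℤ ^ e * + 1             ≈⟨ *-congˡ (-1ℤ ^ e) (≋-sym w²ᵉ≋1) ⟩
      -1ℤ ^ e * (w * w) ^ e     ≡⟨ sym (^-distribʳ-* -1ℤ (w * w) e) ⟩
      (-1ℤ * (w * w)) ^ e       ≈⟨ ^-cong e (≋-sym u²≋-w²) ⟩
      (u * u) ^ e               ≈⟨ u²ᵉ≋1 ⟩
      + 1                       ∎
    where open ≋-Reasoning

-- Fermat's little theorem via the binomial theorem

binomial : ℕ → ℕ → ℕ
binomial n       zero    = 1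
binomial zero    (suc k) = 0
binomial (suc n) (suc k) = binomial n k ℕ.+ binomial n (suc k)

binomial-< : ∀ {n k} → n < k → binomial n k ≡ 0
binomial-< {zero}  {suc k} _         = refl
binomial-< {suc n} {suc k} (s≤s n<k) = cong₂ ℕ._+_ (binomial-< n<k) (binomial-< (ℕP.m<n⇒m<1+n n<k))

binomial-diag : ∀ n → binomial n n ≡ 1
binomial-diag zero    = refl
binomial-diag (suc n) = cong₂ ℕ._+_ (binomial-diag n) (binomial-< (ℕP.n<1+n n))

binomial-1 : ∀ n → binomial n 1 ≡ n
binomial-1 zero    = refl
binomial-1 (suc n) = cong suc (binomial-1 n)

suc-*-binomial : ∀ n k → suc k ℕ.* binomial (suc n) (suc k) ≡ suc n ℕ.* binomial n k
suc-*-binomial zero    zero    = refl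
suc-*-binomial zero    (suc k) = ℕP.*-zeroʳ (suc (suc k))
suc-*-binomial (suc n) zero    rewrite binomial-1 n =
  cong (λ z → suc (suc z)) (trans (ℕP.+-identityʳ n) (sym (ℕP.*-identityʳ n)))
suc-*-binomial (suc n) (suc k) = begin
    suc (suc k) ℕ.* (binomial (suc n) (suc k) ℕ.+ binomial (suc n) (suc (suc k)))
  ≡⟨ split (suc k) (binomial (suc n) (suc k)) (binomial (suc n) (suc (suc k))) ⟩
    suc k ℕ.* binomial (suc n) (suc k) ℕ.+ binomial (suc n) (suc k)
      ℕ.+ suc (suc k) ℕ.* binomial (suc n) (suc (suc k))
  ≡⟨ cong₂ (λ a b → a ℕ.+ binomial (suc n) (suc k) ℕ.+ b) (suc-*-binomial n k) (suc-*-binomial n (suc k)) ⟩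
    suc n ℕ.* binomial n k ℕ.+ binomial (suc n) (suc k) ℕ.+ suc n ℕ.* binomial n (suc k)
  ≡⟨ merge (suc n) (binomial n k) (binomial n (suc k)) ⟩
    suc (suc n) ℕ.* (binomial n k ℕ.+ binomial n (suc k))
  ∎
  where
  open ≡-Reasoning
  split : ∀ a b c → suc a ℕ.* (b ℕ.+ c) ≡ a ℕ.* b ℕ.+ b ℕ.+ suc a ℕ.* c
  split = solveℕ
  merge : ∀ a b c → a ℕ.* b ℕ.+ (b ℕ.+ c) ℕ.+ a ℕ.* c ≡ suc a ℕ.* (b ℕ.+ c)
  merge = solveℕ

∑ : ℕ → (ℕ → ℤ) → ℤ
∑ zero    f = + 0
∑ (suc n) f = f 0 + ∑ n (f ∘ suc)

∑-cong : ∀ n {f g} → (∀ k → f k ≡ g k) → ∑ n f ≡ ∑ n g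
∑-cong zero    e = refl
∑-cong (suc n) e = cong₂ _+_ (e 0) (∑-cong n (e ∘ suc))

∑-distrib-+ : ∀ n f g → ∑ n (λ k → f k + g k) ≡ ∑ n f + ∑ n g
∑-distrib-+ zero    f g = refl
∑-distrib-+ (suc n) f g rewrite ∑-distrib-+ n (f ∘ suc) (g ∘ suc) =
  regroup (f 0) (g 0) (∑ n (f ∘ suc)) (∑ n (g ∘ suc))
  where regroup : ∀ a b c d → a + b + (c + d) ≡ a + c + (b + d)
        regroup = solve-∀

∑-distribˡ-* : ∀ n c f → ∑ n (λ k → c * f k) ≡ c * ∑ n f
∑-distribˡ-* zero    c f = sym (ℤP.*-zeroʳ c)
∑-distribˡ-* (suc n) c f rewrite ∑-distribˡ-* n c (f ∘ suc) = sym (ℤP.*-distribˡ-+ c (f 0) _)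

∑-last : ∀ n f → ∑ (suc n) f ≡ ∑ n f + f n
∑-last zero    f = trans (ℤP.+-identityʳ (f 0)) (sym (ℤP.+-identityˡ (f 0)))
∑-last (suc n) f rewrite ∑-last n (f ∘ suc) = sym (ℤP.+-assoc (f 0) _ _)

∑-∣ : ∀ {m} n f → (∀ k → k < n → m ∣ₛ f k) → m ∣ₛ ∑ n f
∑-∣ {m} zero    f _ = ∣-zero m
∑-∣     (suc n) f h = ∣m∣n⇒∣m+n (h 0 (s≤s z≤n)) (∑-∣ n (f ∘ suc) (λ k k<n → h (suc k) (s≤s k<n)))

binomialExpansion : ℕ → ℤ → ℤ
binomialExpansion n x = ∑ (suc n) (λ k → + binomial n k * x ^ k)

binomialTheorem : ∀ n x → (x + + 1) ^ n ≡ binomialExpansion n x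
binomialTheorem zero    x = refl
binomialTheorem (suc n) x = begin
    (x + + 1) * (x + + 1) ^ n
  ≡⟨ cong ((x + + 1) *_) (binomialTheorem n x) ⟩
    (x + + 1) * binomialExpansion n x
  ≡⟨ ℤP.*-distribʳ-+ (binomialExpansion n x) x (+ 1) ⟩
    x * binomialExpansion n x + + 1 * binomialExpansion n x
  ≡⟨ cong₂ _+_ (sym (∑-distribˡ-* (suc n) x term)) (trans (ℤP.*-identityˡ _) split-first) ⟩
    ∑ (suc n) (λ k → x * term k) + (+ 1 + ∑ (suc n) (term ∘ suc))
  ≡⟨ regroup (∑ (suc n) (λ k → x * term k)) (∑ (suc n) (term ∘ suc)) ⟩
    + 1 + (∑ (suc n) (λ k → x * term k) + ∑ (suc n) (term ∘ suc))
  ≡⟨ cong (_+_ (+ 1)) (sym (∑-distrib-+ (suc n) (λ k → x * term k) (term ∘ suc))) ⟩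
    + 1 + ∑ (suc n) (λ k → x * term k + term (suc k))
  ≡⟨ cong (_+_ (+ 1)) (∑-cong (suc n) pascal) ⟩
    binomialExpansion (suc n) x
  ∎
  where
  open ≡-Reasoning
  term : ℕ → ℤ
  term k = + binomial n k * x ^ k
  regroup : ∀ a b → a + (+ 1 + b) ≡ + 1 + (a + b)
  regroup = solve-∀
  split-first : binomialExpansion n x ≡ + 1 + ∑ (suc n) (term ∘ suc)
  split-first = begin
      binomialExpansion n x
    ≡⟨ sym (ℤP.+-identityʳ _) ⟩
      binomialExpansion n x + + 0 * x ^ suc n
    ≡⟨ cong (λ c → binomialExpansion n x + + c * x ^ suc n) (sym (binomial-< (ℕP.n<1+n n))) ⟩
      binomialExpansion n x + term (suc n)
    ≡⟨ sym (∑-last (suc n) term) ⟩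
      ∑ (suc (suc n)) term
    ≡⟨ cong (_+ ∑ (suc n) (term ∘ suc)) (ℤP.*-identityˡ (+ 1)) ⟩
      + 1 + ∑ (suc n) (term ∘ suc)
    ∎
  pascal : ∀ k → x * term k + term (suc k) ≡ + binomial (suc n) (suc k) * x ^ suc k
  pascal k = begin
      x * (+ binomial n k * x ^ k) + + binomial n (suc k) * x ^ suc k
    ≡⟨ cong (_+ + binomial n (suc k) * x ^ suc k) (shift x (+ binomial n k) (x ^ k)) ⟩
      + binomial n k * x ^ suc k + + binomial n (suc k) * x ^ suc k
    ≡⟨ sym (ℤP.*-distribʳ-+ (x ^ suc k) (+ binomial n k) (+ binomial n (suc k))) ⟩
      (+ binomial n k + + binomial n (suc k)) * x ^ suc k
    ≡⟨ cong (_* x ^ suc k) (sym (ℤP.pos-+ (binomial n k) (binomial n (suc k)))) ⟩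
      + binomial (suc n) (suc k) * x ^ suc k
    ∎
    where shift : ∀ x c y → x * (c * y) ≡ c * (x * y)
          shift = solve-∀

res-1-< : ∀ {p} (z : Zp p) → res z 1 < p
res-1-< {p} z = subst (res z 1 <_) (ℕP.*-identityʳ p) (res-< z 1)

res-2-≡-res-1 : ∀ {p} (z : Zp p) → + p ∣ₛ + res z 2 - + res z 1
res-2-≡-res-1 {p} z = subst (_∣ₛ + res z 2 - + res z 1) (cong +_ (ℕP.*-identityʳ p)) (∣ᵤ⇒∣ (res-compat z 1))

vanishes-mod-p : ∀ {p} F x → VanishesZp p F x → + p ∣ₛ F (lvl x 1)
vanishes-mod-p {p} F x V = subst (_∣ₛ F (lvl x 1)) (cong +_ (ℕP.*-identityʳ p)) (∣ᵤ⇒∣ (V 1))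

vanishes-mod-p² : ∀ {p} F x → VanishesZp p F x → + p * + p ∣ₛ F (lvl x 2)
vanishes-mod-p² {p} F x V =
  subst (_∣ₛ F (lvl x 2)) (trans (cong (λ m → + (p ℕ.* m)) (ℕP.*-identityʳ p)) (ℤP.pos-* p p)) (∣ᵤ⇒∣ (V 2))

constZp : ∀ {p} c → c < p → Zp p
constZp {p} c c<p = record { res = r ; res-< = r-< ; res-compat = compat }
  where
  instance
    p≢0 : ℕ.NonZero p
    p≢0 = ℕ.>-nonZero (ℕP.≤-<-trans z≤n c<p)
  r : ℕ → ℕ
  r zero    = 0
  r (suc k) = c
  r-< : ∀ k → r k < p ℕ.^ k
  r-< zero    = s≤s z≤n
  r-< (suc k) = ℕP.<-≤-trans c<p (ℕP.m≤m*n p (p ℕ.^ k) {{ℕP.m^n≢0 p k}})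
  compat : ∀ k → + (p ℕ.^ k) ∣ + r (suc k) - + r k
  compat zero    = ℕD.1∣ _
  compat (suc k) = ∣⇒∣ᵤ (∣-respʳ-≡ (sym (ℤP.+-inverseʳ (+ c))) (∣-zero (+ (p ℕ.^ suc k))))

Poly : Set
Poly = List ℤ

eval : Poly → ℤ → ℤ
eval []      x = + 0
eval (a ∷ f) x = a + x * eval f x

monomial : ℕ → Poly
monomial zero    = + 1 ∷ []
monomial (suc d) = + 0 ∷ monomial d

eval-monomial : ∀ d x → eval (monomial d) x ≡ x ^ d
eval-monomial zero    x = cong (_+_ (+ 1)) (ℤP.*-zeroʳ x)
eval-monomial (suc d) x rewrite eval-monomial d x = ℤP.+-identityˡ _

length-monomial : ∀ d → length (monomial d) ≡ suc d
length-monomial zero    = refl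
length-monomial (suc d) = cong suc (length-monomial d)

divideByLinear : ℤ → Poly → Poly × ℤ
divideByLinear r []          = [] , + 0
divideByLinear r (a ∷ [])    = [] , a
divideByLinear r (a ∷ b ∷ f) = hornerStep (divideByLinear r (b ∷ f))
  where hornerStep : Poly × ℤ → Poly × ℤ
        hornerStep (q , c) = c ∷ q , a + r * c

quotient : ℤ → Poly → Poly
quotient r f = proj₁ (divideByLinear r f)

remainder : ℤ → Poly → ℤ
remainder r f = proj₂ (divideByLinear r f)

eval-divideByLinear : ∀ r f x → eval f x ≡ (x - r) * eval (quotient r f) x + remainder r f
eval-divideByLinear r []          x = sym (trans (ℤP.+-identityʳ _) (ℤP.*-zeroʳ (x - r)))
eval-divideByLinear r (a ∷ [])    x = rearrange a x r
  where rearrange : ∀ a x r → a + x * + 0 ≡ (x - r) * + 0 + a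
        rearrange = solve-∀
eval-divideByLinear r (a ∷ b ∷ f) x with divideByLinear r (b ∷ f) | eval-divideByLinear r (b ∷ f) x
... | q , c | eq rewrite eq = horner a x r (eval q x) c
  where horner : ∀ a x r q c → a + x * ((x - r) * q + c) ≡ (x - r) * (c + x * q) + (a + r * c)
        horner = solve-∀

length-quotient : ∀ r a f → length (quotient r (a ∷ f)) ≡ length f
length-quotient r a []      = refl
length-quotient r a (b ∷ f) with divideByLinear r (b ∷ f) | length-quotient r b f
... | q , c | eq = cong suc eq

positivesUpTo : ℕ → List ℤ
positivesUpTo zero    = []
positivesUpTo (suc k) = + suc k ∷ positivesUpTo k

length-positivesUpTo : ∀ k → length (positivesUpTo k) ≡ k
length-positivesUpTo zero    = refl
length-positivesUpTo (suc k) = cong suc (length-positivesUpTo k)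

all-positivesUpTo : ∀ {P : ℤ → Set} k → (∀ j → 0 < j → j ℕ.≤ k → P (+ j)) → All P (positivesUpTo k)
all-positivesUpTo zero    h = []
all-positivesUpTo (suc k) h =
  h (suc k) (s≤s z≤n) ℕP.≤-refl ∷ all-positivesUpTo k (λ j 0<j j≤k → h j 0<j (ℕP.m≤n⇒m≤1+n j≤k))

all-or-counterexample : ∀ {P : ℤ → Set} → (∀ a → Dec (P a)) → ∀ k →
                        All P (positivesUpTo k) ⊎ ∃ λ j → 0 < j × j ℕ.≤ k × ¬ P (+ j)
all-or-counterexample P? zero    = inj₁ []
all-or-counterexample P? (suc k) with P? (+ suc k) | all-or-counterexample P? k
... | no ¬P | _                              = inj₂ (suc k , s≤s z≤n , ℕP.≤-refl , ¬P)
... | yes P | inj₁ all                       = inj₁ (P ∷ all)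
... | yes _ | inj₂ (j , 0<j , j≤k , ¬Pj)     = inj₂ (j , 0<j , ℕP.m≤n⇒m≤1+n j≤k , ¬Pj)

module AdicLimit (p : ℕ) .{{_ : ℕ.NonZero p}} where

  P : ℕ → ℤ
  P k = + (p ℕ.^ k)

  P∣P-suc : ∀ k → P k ∣ₛ P (suc k)
  P∣P-suc k = divides (+ p) (ℤP.pos-* p (p ℕ.^ k))

  residue : (ℕ → ℤ) → ℕ → ℕ
  residue s k = ℤ._%ℕ_ (s k) (p ℕ.^ k) {{ℕP.m^n≢0 p k}}

  P∣s-residue : ∀ s k → P k ∣ₛ s k - + residue s k
  P∣s-residue s k = %ℕ-∣ (s k) (p ℕ.^ k) {{ℕP.m^n≢0 p k}}

  limit : (s : ℕ → ℤ) → (∀ k → P k ∣ₛ s (suc k) - s k) → Zp p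
  limit s cauchy = record
    { res        = residue s
    ; res-<      = λ k → ℤDM.n%ℕd<d (s k) (p ℕ.^ k) {{ℕP.m^n≢0 p k}}
    ; res-compat = λ k → ∣⇒∣ᵤ (compat k)
    }
    where
    telescope : ∀ s₁ s₀ r₁ r₀ → ((s₁ - s₀) + (s₀ - r₀)) - (s₁ - r₁) ≡ r₁ - r₀
    telescope = solve-∀
    compat : ∀ k → P k ∣ₛ + residue s (suc k) - + residue s k
    compat k = ∣-respʳ-≡ (telescope (s (suc k)) (s k) (+ residue s (suc k)) (+ residue s k))
      (∣m∣n⇒∣m-n (∣m∣n⇒∣m+n (cauchy k) (P∣s-residue s k)) (∣-trans (P∣P-suc k) (P∣s-residue s (suc k))))

  limit-square : ∀ s cauchy a → (∀ k → P k ∣ₛ s k * s k - a) →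
                 ∀ k → P k ∣ₛ + res (limit s cauchy) k * + res (limit s cauchy) k - a
  limit-square s _ a P∣s²-a k = ∣-respʳ-≡ (difference-of-squares (s k) (+ residue s k) a)
    (∣m∣n⇒∣m-n (P∣s²-a k) (∣n⇒∣m*n (s k + + residue s k) (P∣s-residue s k)))
    where difference-of-squares : ∀ s r a → (s * s - a) - (s + r) * (s - r) ≡ r * r - a
          difference-of-squares = solve-∀

module PrimeResidues (n₀ : ℕ) (p-prime : Prime (suc n₀)) where

  p : ℕ
  p = suc n₀

  open Congruence (+ p) public

  1<p : 1 < p
  1<p = ℕ.nonTrivial⇒n>1 p {{prime⇒nonTrivial p-prime}}

  p∣binomial : ∀ k → suc k < p → p ℕD.∣ binomial p (suc k)
  p∣binomial k k<p with euclidsLemma (suc k) (binomial p (suc k)) p-prime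
                         (subst (p ℕD.∣_) (sym (suc-*-binomial n₀ k)) (ℕD.∣m⇒∣m*n (binomial n₀ k) ℕD.∣-refl))
  ... | inj₁ p∣k+1 = ⊥-elim (ℕP.<⇒≱ k<p (ℕD.∣⇒≤ p∣k+1))
  ... | inj₂ p∣C   = p∣C

  freshmansDream : ∀ x → (x + + 1) ^ p ≋ x ^ p + + 1
  freshmansDream x = ≋-trans (≋-reflexive (binomialTheorem p x)) (mk≋ (∣-respʳ-≡ middle≡ p∣middle))
    where
    term : ℕ → ℤ
    term k = + binomial p k * x ^ k
    p∣middle : + p ∣ₛ ∑ n₀ (term ∘ suc)
    p∣middle = ∑-∣ n₀ (term ∘ suc) (λ k k<n₀ → ∣m⇒∣m*n {m = + binomial p (suc k)} (x ^ suc k) (∣ᵤ⇒∣ (p∣binomial k (s≤s k<n₀))))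
    middle≡ : ∑ n₀ (term ∘ suc) ≡ binomialExpansion p x - (x ^ p + + 1)
    middle≡ = begin
        ∑ n₀ (term ∘ suc)
      ≡⟨ rearrange (∑ n₀ (term ∘ suc)) (x ^ p) ⟩
        (+ 1 + (∑ n₀ (term ∘ suc) + + 1 * x ^ p)) - (x ^ p + + 1)
      ≡⟨ cong (λ c → (+ 1 + (∑ n₀ (term ∘ suc) + + c * x ^ p)) - (x ^ p + + 1)) (sym (binomial-diag p)) ⟩
        (+ 1 + (∑ n₀ (term ∘ suc) + term p)) - (x ^ p + + 1)
      ≡⟨ cong (λ s → (+ 1 + s) - (x ^ p + + 1)) (sym (∑-last n₀ (term ∘ suc))) ⟩
        binomialExpansion p x - (x ^ p + + 1)
      ∎
      where open ≡-Reasoning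
            rearrange : ∀ s y → s ≡ (+ 1 + (s + + 1 * y)) - (y + + 1)
            rearrange = solve-∀

  fermat-ℕ : ∀ n → (+ n) ^ p ≋ + n
  fermat-ℕ zero    = ≋-reflexive (ℤP.*-zeroˡ ((+ 0) ^ n₀))
  fermat-ℕ (suc n) = begin
      (+ suc n) ^ p    ≡⟨ cong (_^ p) (suc≡+1 n) ⟩
      (+ n + + 1) ^ p  ≈⟨ freshmansDream (+ n) ⟩
      (+ n) ^ p + + 1  ≈⟨ +-cong (fermat-ℕ n) ≋-refl ⟩
      + n + + 1        ≡⟨ sym (suc≡+1 n) ⟩
      + suc n          ∎
    where
    open ≋-Reasoning
    suc≡+1 : ∀ n → + suc n ≡ + n + + 1
    suc≡+1 n = trans (ℤP.pos-+ 1 n) (ℤP.+-comm (+ 1) (+ n))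

  fermat : ∀ a → a ^ p ≋ a
  fermat a = begin
      a ^ p  ≈⟨ ^-cong p a≋r ⟩
      r ^ p  ≈⟨ fermat-ℕ (a ℤ.%ℕ p) ⟩
      r      ≈⟨ ≋-sym a≋r ⟩
      a      ∎
    where
    open ≋-Reasoning
    r = + (a ℤ.%ℕ p)
    a≋r : a ≋ r
    a≋r = mk≋ (%ℕ-∣ a p)

  Unit : ℤ → Set
  Unit a = ¬ a ≋ + 0

  positive-<p⇒unit : ∀ c → 0 < c → c < p → Unit (+ c)
  positive-<p⇒unit c 0<c c<p c≋0 = ℕP.<⇒≱ c<p (ℕD.∣⇒≤ {{ℕ.>-nonZero 0<c}} (∣⇒∣ᵤ (≋0⇒∣ c≋0)))

  unit-1 : Unit (+ 1)
  unit-1 = positive-<p⇒unit 1 (s≤s z≤n) 1<p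

  *≋0⇒≋0⊎≋0 : ∀ {a b} → a * b ≋ + 0 → a ≋ + 0 ⊎ b ≋ + 0
  *≋0⇒≋0⊎≋0 {a} {b} ab≋0 with euclidsLemmaℤ p-prime a b (≋0⇒∣ ab≋0)
  ... | inj₁ p∣a = inj₁ (∣⇒≋0 p∣a)
  ... | inj₂ p∣b = inj₂ (∣⇒≋0 p∣b)

  unit-* : ∀ {a b} → Unit a → Unit b → Unit (a * b)
  unit-* ua ub ab≋0 = either ua ub (*≋0⇒≋0⊎≋0 ab≋0)

  unit-^ : ∀ {a} n → Unit a → Unit (a ^ n)
  unit-^ zero    _  = unit-1
  unit-^ (suc n) ua = unit-* ua (unit-^ n ua)

  unit-neg : ∀ {a} → Unit a → Unit (- a)
  unit-neg {a} ua -a≋0 = ua (≋-trans (≋-reflexive (sym (ℤP.neg-involutive a))) (neg-cong -a≋0))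

  unit-√ : ∀ {x u} → x * x ≋ u → Unit u → Unit x
  unit-√ {x} x²≋u uu x≋0 = uu (≋-trans (≋-sym x²≋u) (*-congʳ x x≋0))

  ≋0-by-square : ∀ {y z} c → z ≋ + 0 → y * y ≋ c * (z * z) → y ≋ + 0
  ≋0-by-square {y} {z} c z≋0 y²≋cz² = either (λ y≋0 → y≋0) (λ y≋0 → y≋0) (*≋0⇒≋0⊎≋0 {y} {y} (begin
      y * y          ≈⟨ y²≋cz² ⟩
      c * (z * z)    ≈⟨ *-congˡ c (*-congʳ z z≋0) ⟩
      c * (+ 0 * z)  ≡⟨ ℤP.*-zeroʳ c ⟩
      + 0            ∎))
    where open ≋-Reasoning

  *-cancelˡ-≋ : ∀ {c a b} → Unit c → c * a ≋ c * b → a ≋ b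
  *-cancelˡ-≋ {c} {a} {b} uc ca≋cb with *≋0⇒≋0⊎≋0 {c} {a - b} (mk≋ (∣-respʳ-≡ (factor c a b) (∣diff ca≋cb)))
    where factor : ∀ c a b → c * a - c * b ≡ c * (a - b) - + 0
          factor = solve-∀
  ... | inj₁ c≋0   = ⊥-elim (uc c≋0)
  ... | inj₂ a-b≋0 = mk≋ (≋0⇒∣ a-b≋0)

  fermat-unit : ∀ {a} → Unit a → a ^ n₀ ≋ + 1
  fermat-unit {a} ua = *-cancelˡ-≋ ua (≋-trans (fermat a) (≋-reflexive (sym (ℤP.*-identityʳ a))))

  fermat-unit-square : ∀ {a} e → n₀ ≡ e ℕ.+ e → Unit a → (a * a) ^ e ≋ + 1
  fermat-unit-square {a} e n₀≡e+e ua =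
    ≋-trans (≋-reflexive (sym (^-double a e))) (subst (λ k → a ^ k ≋ + 1) n₀≡e+e (fermat-unit ua))

  h²≋1⇒h≋-1 : ∀ {h} → h * h ≋ + 1 → ¬ h ≋ + 1 → h ≋ -1ℤ
  h²≋1⇒h≋-1 {h} h²≋1 h≉1 = either (λ h-1≋0 → ⊥-elim (h≉1 (mk≋ (≋0⇒∣ h-1≋0)))) (λ h+1≋0 → mk≋ (≋0⇒∣ h+1≋0))
    (*≋0⇒≋0⊎≋0 {h - + 1} {h + + 1} (≋-trans (≋-reflexive (factor h)) (sub-cong h²≋1 (≋-refl {+ 1}))))
    where factor : ∀ h → (h - + 1) * (h + + 1) ≡ h * h - + 1
          factor = solve-∀

  u³≋1⇒u²+u+1≋0 : ∀ {u} → u * (u * u) ≋ + 1 → ¬ u ≋ + 1 → u * u + u + + 1 ≋ + 0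
  u³≋1⇒u²+u+1≋0 {u} u³≋1 u≉1 = either (λ u-1≋0 → ⊥-elim (u≉1 (mk≋ (≋0⇒∣ u-1≋0)))) (λ q≋0 → q≋0)
    (*≋0⇒≋0⊎≋0 {u - + 1} {u * u + u + + 1} (≋-trans (≋-reflexive (factor u)) (sub-cong u³≋1 (≋-refl {+ 1}))))
    where factor : ∀ u → (u - + 1) * (u * u + u + + 1) ≡ u * (u * u) - + 1
          factor = solve-∀

  squarefree-p²∣D*y⇒p∣y : ∀ {D y} → SquareFree D → + p ∣ₛ D → + p * + p ∣ₛ D * y → + p ∣ₛ y
  squarefree-p²∣D*y⇒p∣y {D} {y} squarefree (divides D′ D≡D′p) p²∣Dy =
    either p∤D′ (λ p∣y → p∣y) (euclidsLemmaℤ p-prime D′ y (ℤD.*-cancelˡ-∣ (+ p) p²∣p*D′y))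
    where
    regroup : ∀ d p y → (d * p) * y ≡ p * (d * y)
    regroup = solve-∀
    p²∣p*D′y : + p * + p ∣ₛ + p * (D′ * y)
    p²∣p*D′y = ∣-respʳ-≡ (trans (cong (_* y) D≡D′p) (regroup D′ (+ p) y)) p²∣Dy
    p∤D′ : + p ∣ₛ D′ → + p ∣ₛ y
    p∤D′ (divides D″ D′≡D″p) = ⊥-elim (ℕP.<-irrefl (sym (squarefree p p²∣D)) 1<p)
      where
      p²∣D : + (p ℕ.* p) ∣ D
      p²∣D = ∣⇒∣ᵤ (divides D″ (trans D≡D′p (trans (cong (_* + p) D′≡D″p)
               (trans (ℤP.*-assoc D″ (+ p) (+ p)) (cong (D″ *_) (sym (ℤP.pos-* p p)))))))

  module _ (p>2 : 2 < p) where

    -1≉1 : ¬ -1ℤ ≋ + 1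
    -1≉1 -1≋1 = positive-<p⇒unit 2 (s≤s z≤n) p>2 (mk≋ (∣m⇒∣-m (∣diff -1≋1)))

    -1^m≋1⇒even : ∀ m → -1ℤ ^ m ≋ + 1 → ∃ λ j → m ≡ j ℕ.+ j
    -1^m≋1⇒even zero                _ = 0 , refl
    -1^m≋1⇒even (suc zero)          e = ⊥-elim (-1≉1 e)
    -1^m≋1⇒even (suc (suc m))       e with -1^m≋1⇒even m (≋-trans (≋-reflexive (sym (cancel (-1ℤ ^ m)))) e)
      where cancel : ∀ y → -1ℤ * (-1ℤ * y) ≡ y
            cancel = solve-∀
    ... | j , refl = suc j , cong suc (sym (ℕP.+-suc j j))

module PrimeAbove3 (n₀ : ℕ) (p-prime : Prime (suc n₀)) (p>3 : 3 < suc n₀) where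

  open PrimeResidues n₀ p-prime public

  p>2 : 2 < p
  p>2 = ℕP.<-trans (ℕP.n<1+n 2) p>3

  unit-2 : Unit (+ 2)
  unit-2 = positive-<p⇒unit 2 (s≤s z≤n) p>2

  unit-3 : Unit (+ 3)
  unit-3 = positive-<p⇒unit 3 (s≤s z≤n) p>3

  unit--1 : Unit -1ℤ
  unit--1 = unit-neg unit-1

8∣n→3∣n→[1+n]%24≡1 : ∀ {n} → 8 ℕD.∣ n → 3 ℕD.∣ n → suc n % 24 ≡ 1
8∣n→3∣n→[1+n]%24≡1 {n} 8∣n (ℕD.divides k n≡k*3) = from-8∣k (coprime-divisor (from-yes (coprime? 8 3)) 8∣3k)
  where
  8∣3k : 8 ℕD.∣ 3 ℕ.* k
  8∣3k = subst (8 ℕD.∣_) (trans n≡k*3 (ℕP.*-comm k 3)) 8∣n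
  regroup : ∀ j → j ℕ.* 8 ℕ.* 3 ≡ j ℕ.* 24
  regroup = solveℕ
  from-8∣k : 8 ℕD.∣ k → suc n % 24 ≡ 1
  from-8∣k (ℕD.divides j k≡j*8) = trans (cong (λ m → suc m % 24) n≡j*24) (ℕDM.[m+kn]%n≡m%n 1 j 24)
    where n≡j*24 = trans n≡k*3 (trans (cong (ℕ._* 3) k≡j*8) (regroup j))

[1+n]%24≡1⇒24∣n : ∀ {n} → suc n % 24 ≡ 1 → 24 ℕD.∣ n
[1+n]%24≡1⇒24∣n {n} [1+n]%24≡1 = ℕD.divides (suc n ℕ./ 24)
  (ℕP.suc-injective (trans (ℕDM.m≡m%n+[m/n]*n (suc n) 24) (cong (ℕ._+ (suc n ℕ./ 24) ℕ.* 24) [1+n]%24≡1)))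

module Necessity (n₀ : ℕ) (p-prime : Prime (suc n₀)) (p>3 : 3 < suc n₀) where

  open PrimeAbove3 n₀ p-prime p>3

  p-1-even : ∃ λ m → n₀ ≡ m ℕ.+ m
  p-1-even = -1^m≋1⇒even p>2 n₀ (fermat-unit unit--1)

  -- -1 ≋ (a₄/a₂)² gives 4 ∣ p - 1; moreover z = a₂ + a₄ has z⁴ ≋ -a₁⁴, so -1 is a fourth power
  -- and 8 ∣ p - 1.
  8∣p-1 : ∀ {a₁ a₂ a₄} → Unit a₂ → a₁ * a₁ ≋ + 2 * (a₂ * a₂) → a₄ * a₄ ≋ -1ℤ * (a₂ * a₂) → 8 ℕD.∣ n₀
  8∣p-1 {a₁} {a₂} {a₄} ua₂ a₁²≋2a₂² a₄²≋-a₂² = ℕD.divides i (trans n₀≡4j (trans (cong quadruple j≡i+i) (eight i)))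
    where
    quadruple : ℕ → ℕ
    quadruple j = (j ℕ.+ j) ℕ.+ (j ℕ.+ j)
    eight : ∀ i → ((i ℕ.+ i) ℕ.+ (i ℕ.+ i)) ℕ.+ ((i ℕ.+ i) ℕ.+ (i ℕ.+ i)) ≡ i ℕ.* 8
    eight = solveℕ
    ua₁ : Unit a₁
    ua₁ = unit-√ a₁²≋2a₂² (unit-* unit-2 (unit-* ua₂ ua₂))
    ua₄ : Unit a₄
    ua₄ = unit-√ a₄²≋-a₂² (unit-* unit--1 (unit-* ua₂ ua₂))
    z = a₂ + a₄
    uz : Unit z
    uz = unit-√ ([a+b]²≋2ab a₂ a₄ a₄²≋-a₂²) (unit-* (unit-* unit-2 ua₂) ua₄)
    m = proj₁ p-1-even
    n₀≡m+m = proj₂ p-1-even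
    m-even = -1^m≋1⇒even p>2 m (-1≋square⇒-1^e≋1 {a₄} {a₂} m a₄²≋-a₂²
               (fermat-unit-square m n₀≡m+m ua₄) (fermat-unit-square m n₀≡m+m ua₂))
    j = proj₁ m-even
    n₀≡4j : n₀ ≡ quadruple j
    n₀≡4j = trans n₀≡m+m (cong (λ m → m ℕ.+ m) (proj₂ m-even))
    fourth-power^j≋1 : ∀ {a} → Unit a → ((a * a) * (a * a)) ^ j ≋ + 1
    fourth-power^j≋1 {a} ua =
      ≋-trans (≋-reflexive (sym (^-double (a * a) j))) (fermat-unit-square (j ℕ.+ j) n₀≡4j ua)
    j-even = -1^m≋1⇒even p>2 j (-1≋square⇒-1^e≋1 {z * z} {a₁ * a₁} j ([a+b]⁴≋-c⁴ a₂ a₄ a₁ a₄²≋-a₂² a₁²≋2a₂²)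
               (fourth-power^j≋1 uz) (fourth-power^j≋1 ua₁))
    i = proj₁ j-even
    j≡i+i = proj₂ j-even

  cube-root-of-unity⇒3∣p-1 : ∀ {y w} → y * (y * y) ≋ w * (w * w) → ¬ y ≋ w → Unit w → 3 ℕD.∣ n₀
  cube-root-of-unity⇒3∣p-1 {y} {w} y³≋w³ y≉w uw =
    by-residue (n₀ % 3) (ℕDM.m%n<n n₀ 3) y^r≋w^r (ℕDM.m≡m%n+[m/n]*n n₀ 3)
    where
    q = n₀ ℕ./ 3
    r = n₀ % 3
    uw³ : Unit (w * (w * w))
    uw³ = unit-* uw (unit-* uw uw)
    uy : Unit y
    uy y≋0 = uw³ (≋-trans (≋-sym y³≋w³) (*-congʳ (y * y) y≋0))
    y^r≋w^r : y ^ r ≋ w ^ r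
    y^r≋w^r = *-cancelˡ-≋ (unit-^ q uw³) (begin
        (w * (w * w)) ^ q * y ^ r   ≈⟨ *-congʳ (y ^ r) (^-cong q (≋-sym y³≋w³)) ⟩
        (y * (y * y)) ^ q * y ^ r   ≡⟨ sym (^-by-3s y r q) ⟩
        y ^ (r ℕ.+ q ℕ.* 3)         ≡⟨ cong (y ^_) (sym (ℕDM.m≡m%n+[m/n]*n n₀ 3)) ⟩
        y ^ n₀                      ≈⟨ fermat-unit uy ⟩
        + 1                         ≈⟨ ≋-sym (fermat-unit uw) ⟩
        w ^ n₀                      ≡⟨ cong (w ^_) (ℕDM.m≡m%n+[m/n]*n n₀ 3) ⟩
        w ^ (r ℕ.+ q ℕ.* 3)         ≡⟨ ^-by-3s w r q ⟩
        (w * (w * w)) ^ q * w ^ r   ∎)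
      where open ≋-Reasoning
    by-residue : ∀ r → r < 3 → y ^ r ≋ w ^ r → n₀ ≡ r ℕ.+ q ℕ.* 3 → 3 ℕD.∣ n₀
    by-residue 0 _ _ n₀≡q*3 = ℕD.divides q n₀≡q*3
    by-residue 1 _ y*1≋w*1 _ = ⊥-elim (y≉w (begin
        y        ≡⟨ sym (ℤP.*-identityʳ y) ⟩
        y * + 1  ≈⟨ y*1≋w*1 ⟩
        w * + 1  ≡⟨ ℤP.*-identityʳ w ⟩
        w        ∎))
      where open ≋-Reasoning
    by-residue 2 _ y²≋w² _ = ⊥-elim (y≉w (*-cancelˡ-≋ (unit-* uy uy) (begin
        (y * y) * y        ≡⟨ ℤP.*-comm (y * y) y ⟩
        y * (y * y)        ≈⟨ y³≋w³ ⟩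
        w * (w * w)        ≡⟨ cong (λ c → w * (w * c)) (sym (ℤP.*-identityʳ w)) ⟩
        w * (w * (w * + 1))  ≈⟨ *-congˡ w (≋-sym y²≋w²) ⟩
        w * (y * (y * + 1))  ≡⟨ cong (λ c → w * (y * c)) (ℤP.*-identityʳ y) ⟩
        w * (y * y)        ≡⟨ ℤP.*-comm w (y * y) ⟩
        (y * y) * w        ∎)))
      where open ≋-Reasoning
    by-residue (suc (suc (suc _))) (s≤s (s≤s (s≤s ()))) _ _

  -- (a₀a₄)² ≋ -3a₂⁴, so y = a₀a₄ - a₂² and w = 2a₂² satisfy y³ ≋ w³ with y ≉ w.
  3∣p-1 : ∀ {a₀ a₂ a₄} → Unit a₂ → a₄ * a₄ ≋ -1ℤ * (a₂ * a₂) → a₀ * a₀ ≋ + 3 * (a₂ * a₂) → 3 ℕD.∣ n₀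
  3∣p-1 {a₀} {a₂} {a₄} ua₂ a₄²≋-a₂² a₀²≋3a₂² = cube-root-of-unity⇒3∣p-1 y³≋w³ y≉w uw
    where
    s = a₀ * a₄
    t = a₂ * a₂
    y = s - t
    w = + 2 * t
    s²≋-3t² : s * s ≋ (+ 3 * t) * (-1ℤ * t)
    s²≋-3t² = ≋-trans (≋-reflexive (regroup a₀ a₄)) (*-cong a₀²≋3a₂² a₄²≋-a₂²)
      where regroup : ∀ a b → (a * b) * (a * b) ≡ (a * a) * (b * b)
            regroup = solve-∀
    y³≋w³ : y * (y * y) ≋ w * (w * w)
    y³≋w³ = mk≋ (∣-respʳ-≡ (expand s t) (∣m⇒∣m*n (s - + 3 * t) (∣diff s²≋-3t²)))
      where expand : ∀ s t → (s * s - (+ 3 * t) * (-1ℤ * t)) * (s - + 3 * t)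
                               ≡ (s - t) * ((s - t) * (s - t)) - (+ 2 * t) * ((+ 2 * t) * (+ 2 * t))
            expand = solve-∀
    ut : Unit t
    ut = unit-* ua₂ ua₂
    uw : Unit w
    uw = unit-* unit-2 ut
    y≉w : ¬ y ≋ w
    y≉w y≋w = unit-* (unit-* unit-3 (unit-* unit-2 unit-2)) (unit-* ut ut)
                (mk≋ (∣-respʳ-≡ (expand s t) (∣m∣n⇒∣m-n (∣diff s²≋-3t²) (∣m⇒∣m*n (s + + 3 * t) p∣s-3t))))
      where
      p∣s-3t : + p ∣ₛ s - + 3 * t
      p∣s-3t = ∣-respʳ-≡ (regroup s t) (∣diff y≋w)
        where regroup : ∀ s t → (s - t) - + 2 * t ≡ s - + 3 * t
              regroup = solve-∀
      expand : ∀ s t → (s * s - (+ 3 * t) * (-1ℤ * t)) - (s - + 3 * t) * (s + + 3 * t) ≡ + 12 * (t * t) - + 0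
      expand = solve-∀

  module _ {D : ℤ} (squarefree : SquareFree D) (p∣D : + p ∣ₛ D) where

    module PointModP (x : Fin 5 → Zp p) (x-primitive : Primitive x) (V₁ : VanishesZp p (F₁ D) x)
                     (V₂ : VanishesZp p (F₂ D) x) (V₃ : VanishesZp p (F₃ D) x) where

      a b : Fin 5 → ℤ
      a = lvl x 1
      b = lvl x 2

      a₀ = a zero
      a₁ = a (suc zero)
      a₂ = a (suc (suc zero))
      a₃ = a (suc (suc (suc zero)))
      a₄ = a (suc (suc (suc (suc zero))))

      a₁²≋2a₂² : a₁ * a₁ ≋ + 2 * (a₂ * a₂)
      a₁²≋2a₂² = mk≋ (∣-respʳ-≡ (drop-D a₁ a₂ a₃ D) (∣m∣n⇒∣m-n (vanishes-mod-p (F₂ D) x V₂) (∣m⇒∣m*n (a₃ * a₃) p∣D)))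
        where drop-D : ∀ a₁ a₂ a₃ D → (a₁ * a₁ - + 2 * (a₂ * a₂) + D * (a₃ * a₃)) - D * (a₃ * a₃)
                                        ≡ a₁ * a₁ - + 2 * (a₂ * a₂)
              drop-D = solve-∀

      a₄²≋-a₂² : a₄ * a₄ ≋ -1ℤ * (a₂ * a₂)
      a₄²≋-a₂² = mk≋ (∣-respʳ-≡ (drop-D a₂ a₃ a₄ D)
                   (∣m∣n⇒∣m+n (vanishes-mod-p (F₃ D) x V₃) (∣m⇒∣m*n (a₃ * a₃) (∣n⇒∣m*n (+ 2) p∣D))))
        where drop-D : ∀ a₂ a₃ a₄ D → (a₂ * a₂ - + 2 * D * (a₃ * a₃) + a₄ * a₄) + (+ 2 * D) * (a₃ * a₃)
                                        ≡ a₄ * a₄ - -1ℤ * (a₂ * a₂)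
              drop-D = solve-∀

      a₀²≋3a₂² : a₀ * a₀ ≋ + 3 * (a₂ * a₂)
      a₀²≋3a₂² = mk≋ (∣-respʳ-≡ (eliminate-a₁ a₀ a₁ a₂)
                   (∣m∣n⇒∣m+n (vanishes-mod-p (F₁ D) x V₁) (∣n⇒∣m*n (+ 2) (∣diff a₁²≋2a₂²))))
        where eliminate-a₁ : ∀ a₀ a₁ a₂ → (a₀ * a₀ - + 2 * (a₁ * a₁) + a₂ * a₂) + + 2 * (a₁ * a₁ - + 2 * (a₂ * a₂))
                                            ≡ a₀ * a₀ - + 3 * (a₂ * a₂)
              eliminate-a₁ = solve-∀

      unit-a : ∀ i → ¬ res (x i) 1 ≡ 0 → Unit (a i)
      unit-a i r≢0 = positive-<p⇒unit (res (x i) 1) (ℕP.n≢0⇒n>0 r≢0) (res-1-< (x i))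

      b≋a : ∀ i → b i ≋ a i
      b≋a i = mk≋ (res-2-≡-res-1 (x i))

      b₁ = b (suc zero)
      b₂ = b (suc (suc zero))
      b₃ = b (suc (suc (suc zero)))

      a₂≋0⇒unit-a₃ : a₂ ≋ + 0 → Unit a₃
      a₂≋0⇒unit-a₃ a₂≋0 = coordinate-unit (proj₁ x-primitive) (proj₂ x-primitive)
        where
        a₀≋0 = ≋0-by-square {a₀} {a₂} (+ 3) a₂≋0 a₀²≋3a₂²
        a₁≋0 = ≋0-by-square {a₁} {a₂} (+ 2) a₂≋0 a₁²≋2a₂²
        a₄≋0 = ≋0-by-square {a₄} {a₂} -1ℤ a₂≋0 a₄²≋-a₂²
        coordinate-unit : ∀ i → ¬ res (x i) 1 ≡ 0 → Unit a₃
        coordinate-unit zero                         r≢0 = ⊥-elim (unit-a zero r≢0 a₀≋0)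
        coordinate-unit (suc zero)                   r≢0 = ⊥-elim (unit-a (suc zero) r≢0 a₁≋0)
        coordinate-unit (suc (suc zero))             r≢0 = ⊥-elim (unit-a (suc (suc zero)) r≢0 a₂≋0)
        coordinate-unit (suc (suc (suc zero)))       r≢0 = unit-a (suc (suc (suc zero))) r≢0
        coordinate-unit (suc (suc (suc (suc zero)))) r≢0 = ⊥-elim (unit-a (suc (suc (suc (suc zero)))) r≢0 a₄≋0)

      a≋0⇒p²∣b² : ∀ i → a i ≋ + 0 → + p * + p ∣ₛ b i * b i
      a≋0⇒p²∣b² i aᵢ≋0 = *-pres-∣ p∣bᵢ p∣bᵢ
        where p∣bᵢ : + p ∣ₛ b i
              p∣bᵢ = ≋0⇒∣ (≋-trans (b≋a i) aᵢ≋0)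

      a₂≋0⇒p²∣Db₃² : a₂ ≋ + 0 → + p * + p ∣ₛ D * (b₃ * b₃)
      a₂≋0⇒p²∣Db₃² a₂≋0 = ∣-respʳ-≡ (isolate b₁ b₂ b₃ D)
        (∣m∣n⇒∣m+n (∣m∣n⇒∣m-n (vanishes-mod-p² (F₂ D) x V₂) (a≋0⇒p²∣b² (suc zero) a₁≋0))
                   (∣n⇒∣m*n (+ 2) (a≋0⇒p²∣b² (suc (suc zero)) a₂≋0)))
        where
        a₁≋0 = ≋0-by-square {a₁} {a₂} (+ 2) a₂≋0 a₁²≋2a₂²
        isolate : ∀ b₁ b₂ b₃ D → (b₁ * b₁ - + 2 * (b₂ * b₂) + D * (b₃ * b₃)) - b₁ * b₁ + + 2 * (b₂ * b₂)
                                   ≡ D * (b₃ * b₃)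
        isolate = solve-∀

      -- If p ∣ a₂ then p ∣ a₀, a₁, a₄, so a₃ is a unit; but mod p² the second quadric gives p² ∣ D b₃²,
      -- which for squarefree D forces p ∣ b₃ ≡ a₃.
      unit-a₂ : Unit a₂
      unit-a₂ a₂≋0 = a₂≋0⇒unit-a₃ a₂≋0 (≋-trans (≋-sym (b≋a (suc (suc (suc zero))))) (∣⇒≋0 p∣b₃))
        where
        p∣b₃ : + p ∣ₛ b₃
        p∣b₃ = either (λ d → d) (λ d → d)
                 (euclidsLemmaℤ p-prime b₃ b₃ (squarefree-p²∣D*y⇒p∣y {D} {b₃ * b₃} squarefree p∣D (a₂≋0⇒p²∣Db₃² a₂≋0)))

    hasQpPoint⇒p%24≡1 : HasQpPoint D p → p % 24 ≡ 1
    hasQpPoint⇒p%24≡1 (x , x-primitive , V₁ , V₂ , V₃) =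
      8∣n→3∣n→[1+n]%24≡1 (8∣p-1 {a₁} {a₂} {a₄} unit-a₂ a₁²≋2a₂² a₄²≋-a₂²)
                         (3∣p-1 {a₀} {a₂} {a₄} unit-a₂ a₄²≋-a₂² a₀²≋3a₂²)
      where open PointModP x x-primitive V₁ V₂ V₃

module RootCounting (n₀ : ℕ) (p-prime : Prime (suc n₀)) where

  open PrimeResidues n₀ p-prime

  ZeroPoly : Poly → Set
  ZeroPoly = All (_≋ + 0)

  Distinct : List ℤ → Set
  Distinct = AllPairs (λ r s → ¬ s ≋ r)

  zero-quotient-remainder⇒zero : ∀ r f → ZeroPoly (quotient r f) → remainder r f ≋ + 0 → ZeroPoly f
  zero-quotient-remainder⇒zero r []          _ _ = []
  zero-quotient-remainder⇒zero r (a ∷ [])    _ a≋0 = a≋0 ∷ []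
  zero-quotient-remainder⇒zero r (a ∷ b ∷ f) with divideByLinear r (b ∷ f) | zero-quotient-remainder⇒zero r (b ∷ f)
  ... | q , c | ih = λ { (c≋0 ∷ q≋0) a+rc≋0 → a≋0 c≋0 a+rc≋0 ∷ ih q≋0 c≋0 }
    where
    a≋0 : c ≋ + 0 → a + r * c ≋ + 0 → a ≋ + 0
    a≋0 c≋0 a+rc≋0 = begin
      a                    ≡⟨ rearrange a r c ⟩
      (a + r * c) - r * c  ≈⟨ sub-cong a+rc≋0 (*-congˡ r c≋0) ⟩
      + 0 - r * + 0        ≡⟨ cong (λ z → + 0 - z) (ℤP.*-zeroʳ r) ⟩
      + 0                  ∎
      where
      open ≋-Reasoning
      rearrange : ∀ a r c → a ≡ (a + r * c) - r * c
      rearrange = solve-∀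

  quotient-vanishes : ∀ {r s} f → remainder r f ≋ + 0 → eval f s ≋ + 0 → ¬ s ≋ r → eval (quotient r f) s ≋ + 0
  quotient-vanishes {r} {s} f c≋0 fs≋0 s≉r =
    either (λ s-r≋0 → ⊥-elim (s≉r (mk≋ (≋0⇒∣ s-r≋0)))) (λ qs≋0 → qs≋0) (*≋0⇒≋0⊎≋0 {s - r} (begin
      (s - r) * eval (quotient r f) s                  ≡⟨ rearrange (s - r) (eval (quotient r f) s) (remainder r f) ⟩
      ((s - r) * eval (quotient r f) s + remainder r f) - remainder r f
                                                       ≡⟨ cong (_- remainder r f) (sym (eval-divideByLinear r f s)) ⟩
      eval f s - remainder r f                         ≈⟨ sub-cong fs≋0 c≋0 ⟩
      + 0                                              ∎))
    where
    open ≋-Reasoning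
    rearrange : ∀ x y c → x * y ≡ (x * y + c) - c
    rearrange = solve-∀

  root-bound : ∀ rs f → length f ℕ.≤ length rs → Distinct rs → All (λ r → eval f r ≋ + 0) rs → ZeroPoly f
  root-bound _        []      _         _                 _                = []
  root-bound (r ∷ rs) (a ∷ f) (s≤s len) (r-new ∷ distinct) (fr≋0 ∷ frs≋0) =
    zero-quotient-remainder⇒zero r (a ∷ f) (root-bound rs (quotient r (a ∷ f)) len′ distinct q-roots) c≋0
    where
    len′ : length (quotient r (a ∷ f)) ℕ.≤ length rs
    len′ = subst (ℕ._≤ length rs) (sym (length-quotient r a f)) len
    c≋0 : remainder r (a ∷ f) ≋ + 0
    c≋0 = ≋-trans (≋-reflexive (sym (trans (eval-divideByLinear r (a ∷ f) r) (cancel r _ _)))) fr≋0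
      where cancel : ∀ r q c → (r - r) * q + c ≡ c
            cancel = solve-∀
    roots-of-quotient : ∀ ss → All (λ s → ¬ s ≋ r) ss → All (λ s → eval (a ∷ f) s ≋ + 0) ss →
                        All (λ s → eval (quotient r (a ∷ f)) s ≋ + 0) ss
    roots-of-quotient []       []             []             = []
    roots-of-quotient (s ∷ ss) (s≉r ∷ ss≉r)   (fs≋0 ∷ fss≋0) =
      quotient-vanishes (a ∷ f) c≋0 fs≋0 s≉r ∷ roots-of-quotient ss ss≉r fss≋0
    q-roots = roots-of-quotient rs r-new frs≋0

  distinct-positivesUpTo : ∀ k → k < p → Distinct (positivesUpTo k)
  distinct-positivesUpTo zero    _   = []
  distinct-positivesUpTo (suc k) k<p = all-positivesUpTo k differ ∷ distinct-positivesUpTo k (ℕP.<-trans (ℕP.n<1+n k) k<p)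
    where
    differ : ∀ j → 0 < j → j ℕ.≤ k → ¬ + j ≋ + suc k
    differ j 0<j j≤k j≋k+1 = positive-<p⇒unit (suc k ℕ.∸ j) (ℕP.m<n⇒0<n∸m (s≤s j≤k))
      (ℕP.≤-<-trans (ℕP.m∸n≤m (suc k) j) k<p) (∣⇒≋0 (∣-respʳ-≡ (ℤP.neg-involutive _)
        (∣m⇒∣-m (∣-respʳ-≡ (trans (ℤP.m-n≡m⊖n j (suc k)) (ℤP.⊖-< (s≤s j≤k))) (∣diff j≋k+1)))))

  -- Xᵈ - 1 has at most d < p - 1 roots, so some residue 1 ≤ g ≤ p - 1 is not one.
  ∃-unit-g^d≉1 : ∀ d → 0 < d → d < n₀ → ∃ λ g → Unit g × ¬ g ^ d ≋ + 1
  ∃-unit-g^d≉1 (suc e) _ d<n₀ = either all-roots counterexample (all-or-counterexample (λ s → eval f s ≋? + 0) n₀)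
    where
    f : Poly
    f = -1ℤ ∷ monomial e
    all-roots : All (λ s → eval f s ≋ + 0) (positivesUpTo n₀) → ∃ λ g → Unit g × ¬ g ^ suc e ≋ + 1
    all-roots roots with root-bound (positivesUpTo n₀) f len (distinct-positivesUpTo n₀ (ℕP.n<1+n n₀)) roots
      where len = subst₂ ℕ._≤_ (cong suc (sym (length-monomial e))) (sym (length-positivesUpTo n₀)) d<n₀
    ... | -1≋0 ∷ _ = ⊥-elim (unit-neg unit-1 -1≋0)
    counterexample : (∃ λ j → 0 < j × j ℕ.≤ n₀ × ¬ eval f (+ j) ≋ + 0) → ∃ λ g → Unit g × ¬ g ^ suc e ≋ + 1
    counterexample (j , 0<j , j≤n₀ , not-root) = + j , positive-<p⇒unit j 0<j (s≤s j≤n₀) , λ jᵈ≋1 →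
      not-root (≋-trans (≋-reflexive (cong (λ y → -1ℤ + + j * y) (eval-monomial e (+ j)))) (+-cong (≋-refl { -1ℤ}) jᵈ≋1))

module HenselLifting (n₀ : ℕ) (p-prime : Prime (suc n₀)) (p>2 : 2 < suc n₀) where

  open PrimeResidues n₀ p-prime
  open AdicLimit p

  unit-inverse : ∀ {u} → Unit u → ∃ λ e → u * e ≋ + 1
  unit-inverse {u} uu = u ^ ℕ.pred n₀ ,
    subst (λ k → u ^ k ≋ + 1) (sym (ℕP.suc-pred n₀ {{ℕ.>-nonZero (ℕP.≤-pred 1<p)}})) (fermat-unit uu)

  module _ {a r : ℤ} (ur : Unit r) (r²≋a : r * r ≋ a) where

    e : ℤ
    e = proj₁ (unit-inverse (unit-* (positive-<p⇒unit 2 (s≤s z≤n) p>2) ur))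

    2re≋1 : (+ 2 * r) * e ≋ + 1
    2re≋1 = proj₂ (unit-inverse (unit-* (positive-<p⇒unit 2 (s≤s z≤n) p>2) ur))

    Approx : ℕ → ℤ → Set
    Approx k s = P (suc k) ∣ₛ s * s - a × + p ∣ₛ s - r

    -- Newton's step s ↦ s - (s² - a)·e, with e an inverse of 2r ≡ 2s.
    newton : ∀ k s → Approx k s → Σ ℤ (Approx (suc k))
    newton k s (divides c s²-a≡cPₖ , p∣s-r) = s′ , P∣s′²-a , p∣s′-r
      where
      Pₖ = P (suc k)
      s′ = s - c * e * Pₖ
      p∣1-2se : + p ∣ₛ + 1 - + 2 * s * e
      p∣1-2se = ∣-respʳ-≡ (rearrange r s e) (∣m∣n⇒∣m-n (∣m⇒∣-m (∣diff 2re≋1)) (∣n⇒∣m*n (+ 2 * e) p∣s-r))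
        where rearrange : ∀ r s e → - ((+ 2 * r) * e - + 1) - (+ 2 * e) * (s - r) ≡ + 1 - + 2 * s * e
              rearrange = solve-∀
      expand : s′ * s′ - a ≡ (c * Pₖ) * (+ 1 - + 2 * s * e) + (c * e * c * e) * (Pₖ * Pₖ)
      expand = begin
          s′ * s′ - a
        ≡⟨ square-out s a c e Pₖ ⟩
          (s * s - a) - + 2 * s * (c * e * Pₖ) + (c * e * Pₖ) * (c * e * Pₖ)
        ≡⟨ cong (λ z → z - + 2 * s * (c * e * Pₖ) + (c * e * Pₖ) * (c * e * Pₖ)) s²-a≡cPₖ ⟩
          c * Pₖ - + 2 * s * (c * e * Pₖ) + (c * e * Pₖ) * (c * e * Pₖ)
        ≡⟨ regroup s c e Pₖ ⟩
          (c * Pₖ) * (+ 1 - + 2 * s * e) + (c * e * c * e) * (Pₖ * Pₖ)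
        ∎
        where
        open ≡-Reasoning
        square-out : ∀ s a c e P → (s - c * e * P) * (s - c * e * P) - a
                                   ≡ (s * s - a) - + 2 * s * (c * e * P) + (c * e * P) * (c * e * P)
        square-out = solve-∀
        regroup : ∀ s c e P → c * P - + 2 * s * (c * e * P) + (c * e * P) * (c * e * P)
                              ≡ (c * P) * (+ 1 - + 2 * s * e) + (c * e * c * e) * (P * P)
        regroup = solve-∀
      Pₖ₊₁≡Pₖp : P (suc (suc k)) ≡ Pₖ * + p
      Pₖ₊₁≡Pₖp = trans (ℤP.pos-* p (p ℕ.^ suc k)) (ℤP.*-comm (+ p) Pₖ)
      p∣Pₖ : + p ∣ₛ Pₖ
      p∣Pₖ = divides (P k) (trans (ℤP.pos-* p (p ℕ.^ k)) (ℤP.*-comm (+ p) (P k)))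
      P∣s′²-a : P (suc (suc k)) ∣ₛ s′ * s′ - a
      P∣s′²-a = ∣-respʳ-≡ (sym expand) (∣m∣n⇒∣m+n
        (subst (_∣ₛ (c * Pₖ) * (+ 1 - + 2 * s * e)) (sym Pₖ₊₁≡Pₖp) (*-pres-∣ (∣n⇒∣m*n c (∣-refl {Pₖ})) p∣1-2se))
        (∣n⇒∣m*n (c * e * c * e) (subst (_∣ₛ Pₖ * Pₖ) (sym Pₖ₊₁≡Pₖp) (*-pres-∣ (∣-refl {Pₖ}) p∣Pₖ))))
      p∣s′-r : + p ∣ₛ s′ - r
      p∣s′-r = ∣-respʳ-≡ (rearrange s r (c * e) Pₖ) (∣m∣n⇒∣m-n p∣s-r (∣n⇒∣m*n (c * e) p∣Pₖ))
        where rearrange : ∀ s r x P → (s - r) - x * P ≡ (s - x * P) - r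
              rearrange = solve-∀

    approximation : ∀ k → Σ ℤ (Approx k)
    approximation zero    = r , subst (_∣ₛ r * r - a) (sym (cong +_ (ℕP.*-identityʳ p))) (∣diff r²≋a) , ∣diff (≋-refl {r})
    approximation (suc k) = newton k (proj₁ (approximation k)) (proj₂ (approximation k))

    s : ℕ → ℤ
    s k = proj₁ (approximation k)

    P∣s-step : ∀ k → P (suc k) ∣ₛ s (suc k) - s k
    P∣s-step k with approximation k
    ... | s , (divides c _ , _) = ∣-respʳ-≡ (rearrange s (c * e) (P (suc k))) (∣m⇒∣-m (∣n⇒∣m*n (c * e) (∣-refl {P (suc k)})))
      where rearrange : ∀ s x P → - (x * P) ≡ (s - x * P) - s
            rearrange = solve-∀

    cauchy : ∀ k → P k ∣ₛ s (suc k) - s k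
    cauchy k = ∣-trans (P∣P-suc k) (P∣s-step k)

    √a : Zp p
    √a = limit s cauchy

    √a-square : ∀ k → P k ∣ₛ + res √a k * + res √a k - a
    √a-square = limit-square s cauchy a (λ k → ∣-trans (P∣P-suc k) (proj₁ (proj₂ (approximation k))))

  SqrtZp : ℤ → Set
  SqrtZp a = Σ (Zp p) λ z → ∀ k → P k ∣ₛ + res z k * + res z k - a

  hensel : ∀ {a} r → Unit a → r * r ≋ a → SqrtZp a
  hensel {a} r ua r²≋a = √a ur r²≋a , √a-square ur r²≋a
    where ur = unit-√ {r} {a} r²≋a ua

module RootsOfUnity (n₀ : ℕ) (p-prime : Prime (suc n₀)) (p>3 : 3 < suc n₀) (24∣p-1 : 24 ℕD.∣ n₀) where

  open PrimeAbove3 n₀ p-prime p>3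
  open RootCounting n₀ p-prime

  Q : ℕ
  Q = ℕD._∣_.quotient 24∣p-1

  n₀≡Q*24 : n₀ ≡ Q ℕ.* 24
  n₀≡Q*24 = ℕD._∣_.equality 24∣p-1

  0<Q : 0 < Q
  0<Q = ℕP.n≢0⇒n>0 λ Q≡0 → ℕP.<⇒≱ p>3 (s≤s (subst (ℕ._≤ 2) (sym (trans n₀≡Q*24 (cong (ℕ._* 24) Q≡0))) z≤n))

  instance
    Q≢0 : ℕ.NonZero Q
    Q≢0 = ℕ.>-nonZero 0<Q

  Q*k<p-1 : ∀ k → k < 24 → Q ℕ.* k < n₀
  Q*k<p-1 k k<24 = subst (Q ℕ.* k <_) (sym n₀≡Q*24) (ℕP.*-monoʳ-< Q k<24)

  ^-+-≡ : ∀ g a b {c} → a ℕ.+ b ≡ c → g ^ a * g ^ b ≡ g ^ c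
  ^-+-≡ g a b refl = sym (ℤP.^-distribˡ-+-* g a b)

  fermat-unit-split : ∀ {g} a b → a ℕ.+ b ≡ Q ℕ.* 24 → Unit g → g ^ a * g ^ b ≋ + 1
  fermat-unit-split {g} a b a+b≡n₀ ug =
    ≋-trans (≋-reflexive (^-+-≡ g a b (trans a+b≡n₀ (sym n₀≡Q*24)))) (fermat-unit ug)

  -- h = g^{12Q} is a square root of 1 other than 1, hence -1, and t = g^{3Q} has t⁴ = h.
  eighth-root : ∃ λ t → (t * t) * (t * t) ≋ -1ℤ
  eighth-root = from-nonroot (∃-unit-g^d≉1 (Q ℕ.* 12) (ℕP.<-≤-trans 0<Q (ℕP.m≤m*n Q 12)) (Q*k<p-1 12 (ℕP.m≤m+n 13 11)))
    where
    from-nonroot : (∃ λ g → Unit g × ¬ g ^ (Q ℕ.* 12) ≋ + 1) → ∃ λ t → (t * t) * (t * t) ≋ -1ℤ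
    from-nonroot (g , ug , g^12Q≉1) = t , ≋-trans (≋-reflexive t⁴≡g^12Q) (h²≋1⇒h≋-1 h²≋1 g^12Q≉1)
      where
      t = g ^ (Q ℕ.* 3)
      four-threes : ∀ Q → (Q ℕ.* 3 ℕ.+ Q ℕ.* 3) ℕ.+ (Q ℕ.* 3 ℕ.+ Q ℕ.* 3) ≡ Q ℕ.* 12
      four-threes = solveℕ
      two-twelves : ∀ Q → Q ℕ.* 12 ℕ.+ Q ℕ.* 12 ≡ Q ℕ.* 24
      two-twelves = solveℕ
      t⁴≡g^12Q : (t * t) * (t * t) ≡ g ^ (Q ℕ.* 12)
      t⁴≡g^12Q = trans (cong₂ _*_ (^-+-≡ g (Q ℕ.* 3) (Q ℕ.* 3) refl) (^-+-≡ g (Q ℕ.* 3) (Q ℕ.* 3) refl))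
                         (^-+-≡ g (Q ℕ.* 3 ℕ.+ Q ℕ.* 3) (Q ℕ.* 3 ℕ.+ Q ℕ.* 3) (four-threes Q))
      h²≋1 : g ^ (Q ℕ.* 12) * g ^ (Q ℕ.* 12) ≋ + 1
      h²≋1 = fermat-unit-split (Q ℕ.* 12) (Q ℕ.* 12) (two-twelves Q) ug

  cube-root : ∃ λ u → u * u + u + + 1 ≋ + 0
  cube-root = from-nonroot (∃-unit-g^d≉1 (Q ℕ.* 8) (ℕP.<-≤-trans 0<Q (ℕP.m≤m*n Q 8)) (Q*k<p-1 8 (ℕP.m≤m+n 9 15)))
    where
    from-nonroot : (∃ λ g → Unit g × ¬ g ^ (Q ℕ.* 8) ≋ + 1) → ∃ λ u → u * u + u + + 1 ≋ + 0
    from-nonroot (g , ug , g^8Q≉1) = u , u³≋1⇒u²+u+1≋0 u³≋1 g^8Q≉1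
      where
      u = g ^ (Q ℕ.* 8)
      three-eights : ∀ Q → Q ℕ.* 8 ℕ.+ (Q ℕ.* 8 ℕ.+ Q ℕ.* 8) ≡ Q ℕ.* 24
      three-eights = solveℕ
      u³≋1 : u * (u * u) ≋ + 1
      u³≋1 = ≋-trans (≋-reflexive (cong (u *_) (^-+-≡ g (Q ℕ.* 8) (Q ℕ.* 8) refl)))
                     (fermat-unit-split (Q ℕ.* 8) (Q ℕ.* 8 ℕ.+ Q ℕ.* 8) (three-eights Q) ug)

module Construction (n₀ : ℕ) (p-prime : Prime (suc n₀)) (p>3 : 3 < suc n₀) (24∣p-1 : 24 ℕD.∣ n₀) where

  open PrimeAbove3 n₀ p-prime p>3
  open RootsOfUnity n₀ p-prime p>3 24∣p-1
  open HenselLifting n₀ p-prime p>2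

  t u : ℤ
  t = proj₁ eighth-root
  u = proj₁ cube-root

  i : ℤ
  i = t * t

  i²≋-1 : i * i ≋ -1ℤ
  i²≋-1 = proj₂ eighth-root

  r₂ : ℤ
  r₂ = t - t * i

  r₂²≋2 : r₂ * r₂ ≋ + 2
  r₂²≋2 = √2-from-t⁴≋-1 t i²≋-1

  r₃ : ℤ
  r₃ = (+ 2 * u + + 1) * i

  r₃²≋3 : r₃ * r₃ ≋ + 3
  r₃²≋3 = √3-from-u²+u+1≋0 u i (proj₂ cube-root) i²≋-1

  √-1ₚ : SqrtZp -1ℤ
  √-1ₚ = hensel i unit--1 i²≋-1

  √2ₚ : SqrtZp (+ 2)
  √2ₚ = hensel r₂ unit-2 r₂²≋2

  √3ₚ : SqrtZp (+ 3)
  √3ₚ = hensel r₃ unit-3 r₃²≋3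

  point : Fin 5 → Zp p
  point zero                          = proj₁ √3ₚ
  point (suc zero)                    = proj₁ √2ₚ
  point (suc (suc zero))              = constZp 1 1<p
  point (suc (suc (suc zero)))        = constZp 0 (ℕP.<-trans (s≤s z≤n) 1<p)
  point (suc (suc (suc (suc zero))))  = proj₁ √-1ₚ

  vanishes₁ : ∀ D → VanishesZp p (F₁ D) point
  vanishes₁ D zero    = ℕD.1∣ _
  vanishes₁ D (suc k) = ∣⇒∣ᵤ (∣-respʳ-≡ (combine (+ res (proj₁ √3ₚ) (suc k)) (+ res (proj₁ √2ₚ) (suc k)))
                          (∣m∣n⇒∣m-n (proj₂ √3ₚ (suc k)) (∣n⇒∣m*n (+ 2) (proj₂ √2ₚ (suc k)))))
    where combine : ∀ x y → (x * x - + 3) - + 2 * (y * y - + 2) ≡ x * x - + 2 * (y * y) + + 1 * + 1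
          combine = solve-∀

  vanishes₂ : ∀ D → VanishesZp p (F₂ D) point
  vanishes₂ D zero    = ℕD.1∣ _
  vanishes₂ D (suc k) = ∣⇒∣ᵤ (∣-respʳ-≡ (combine (+ res (proj₁ √2ₚ) (suc k)) D) (proj₂ √2ₚ (suc k)))
    where combine : ∀ y D → y * y - + 2 ≡ y * y - + 2 * (+ 1 * + 1) + D * (+ 0 * + 0)
          combine = solve-∀

  vanishes₃ : ∀ D → VanishesZp p (F₃ D) point
  vanishes₃ D zero    = ℕD.1∣ _
  vanishes₃ D (suc k) = ∣⇒∣ᵤ (∣-respʳ-≡ (combine (+ res (proj₁ √-1ₚ) (suc k)) D) (proj₂ √-1ₚ (suc k)))
    where combine : ∀ y D → y * y - -1ℤ ≡ + 1 * + 1 - + 2 * D * (+ 0 * + 0) + y * y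
          combine = solve-∀

  hasQpPoint : ∀ D → HasQpPoint D p
  hasQpPoint D = point , (suc (suc zero) , λ ()) , vanishes₁ D , vanishes₂ D , vanishes₃ D

mainTheorem11 : (D : ℤ) (p : ℕ) → SquareFree D → Prime p → 3 < p → (+ p) ∣ D →
    (HasQpPoint D p ⇔ (p % 24 ≡ 1))
mainTheorem11 D zero     _          _       ()  _
mainTheorem11 D (suc n₀) squarefree p-prime p>3 p∣D = mk⇔
  (hasQpPoint⇒p%24≡1 {D} squarefree (∣ᵤ⇒∣ p∣D))
  (λ p%24≡1 → Construction.hasQpPoint n₀ p-prime p>3 ([1+n]%24≡1⇒24∣n p%24≡1) D)
  where open Necessity n₀ p-prime p>3
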